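{- Let $t>1$ be an odd natural number, $n=2t+1$, and let $k$ be a natural number with $\gcd(k,n)=1$. Then the inverse $(2^t+2^{(3t+1)/2}-1)^{ -1}$ modulo $2^n-1$ of the odd Niho exponent is never cyclotomic equivalent to $e(l,k)$ over $\mathbb{F}_{2^n}$, for any natural number $l$.
   Context: For natural numbers $l,k$, $e(l,k)=\sum_{j=0}^{l-1}2^{jk}$. Two exponents $d,e$ are cyclotomic equivalent over $\mathbb{F}_{2^n}$ if there is a natural number $a$ with $2^a d\equiv e\pmod{2^n-1}$, or (when $\gcd(d,2^n-1)=1$) $2^a d^{ -1}\equiv e\pmod{2^n-1}$, where $d^{ -1}$ is the inverse of $d$ modulo $2^n-1$. -}

module Defs where

open import Data.Nat using (ℕ; zero; suc; _+_; _*_; _∸_; _^_; _/_)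
open import Data.Nat.Coprimality using (Coprime)
open import Data.Product using (Σ; _×_)
open import Data.Sum using (_⊎_)
open import Relation.Binary.PropositionalEquality using (_≡_)

-- a ≡ b (mod m), stated without division: a + i*m = b + j*m for some i, j
infix 4 _≋_[mod_]
_≋_[mod_] : ℕ → ℕ → ℕ → Set
a ≋ b [mod m ] = Σ ℕ λ i → Σ ℕ λ j → a + i * m ≡ b + j * m

e : ℕ → ℕ → ℕ
e zero    k = 0
e (suc l) k = e l k + 2 ^ (l * k)

IsInvMod : ℕ → ℕ → ℕ → Set
IsInvMod m d x = d * x ≋ 1 [mod m ]

CycEquiv : ℕ → ℕ → ℕ → Set
CycEquiv n d f =
  (Σ ℕ λ a → 2 ^ a * d ≋ f [mod (2 ^ n ∸ 1) ])
  ⊎ (Coprime d (2 ^ n ∸ 1) ×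
     (Σ ℕ λ dinv → IsInvMod (2 ^ n ∸ 1) d dinv ×
        (Σ ℕ λ a → 2 ^ a * dinv ≋ f [mod (2 ^ n ∸ 1) ])))

nihoExp : ℕ → ℕ
nihoExp t = 2 ^ t + 2 ^ ((3 * t + 1) / 2) ∸ 1

-- Let s = (3t + 1)/2, d = 2^t + 2^s - 1 and M = 2^n - 1. If 2^a d⁻¹ ≡ e(l,k), multiplying by d and using
-- e(l,k) 2^k + 1 = e(l,k) + 2^(lk) gives d 2^(lk) + 2^a ≡ d + 2^(a+k) (mod M); in the other case, 2^a d ≡ e(l,k),
-- one gets d 2^k + 2^c ≡ d + 2^(lk+c) after multiplying by the inverse 2^c of 2^a. Such a congruence
-- d 2^u + 2^v ≡ d + 2^w forces u ≡ 0 and v ≡ w (mod n), so n ∣ k, contradicting gcd(k,n) = 1 as n > 1.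
-- This rigidity is combinatorial: modulo M, multiplication by 2^u rotates n-bit words, the word of d + 2^a
-- consists of the bits [0,t) together with s and a (up to one carry), and no nontrivial rotation maps one such
-- word to another.

module Submission where

open import Defs
open import Data.Nat using (ℕ; _+_; _*_; _∸_; _^_; _<_)
open import Data.Nat.Divisibility using (_∣_)
open import Data.Nat.Coprimality using (Coprime)
open import Relation.Nullary using (¬_)

open import Data.Nat using (zero; suc; pred; _≤_; z≤n; s≤s; _<ᵇ_; _≡ᵇ_; NonZero; >-nonZero; _/_; _%_)
open import Data.Nat.Properties
open import Data.Nat.DivMod using (m≡m%n+[m/n]*n; m%n<n; m<n⇒m%n≡m; [m+kn]%n≡m%n; m*n/n≡m)
open import Data.Nat.Divisibility using (divides; ∣-refl; m%n≡0⇒n∣m; ∣m+n∣m⇒∣n; ∣m∣n⇒∣m+n; n∣m*n)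
open import Data.Nat.Tactic.RingSolver using (solve-∀)
open import Algebra.Properties.CommutativeSemigroup +-commutativeSemigroup
  using (x∙yz≈y∙xz; xy∙z≈xz∙y; xy∙z≈yz∙x)
import Algebra.Properties.CommutativeSemigroup *-commutativeSemigroup as *-CS
open import Data.Bool using (Bool; true; false; if_then_else_; T; _∨_)
open import Data.Bool.Properties using (T-≡; ∨-identityʳ; ∨-zeroʳ)
open import Data.Product using (∃-syntax; _,_; _×_; proj₁; proj₂)
open import Data.Empty using (⊥; ⊥-elim)
open import Data.Sum using (_⊎_; inj₁; inj₂)
open import Function using (_∘_)
open import Function.Bundles using (Equivalence)
open import Level using (0ℓ)
open import Relation.Binary.Bundles using (Setoid)
import Relation.Binary.Reasoning.Setoid
open import Relation.Binary.Definitions using (tri<; tri≈; tri>)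
open import Relation.Binary.PropositionalEquality
open import Relation.Nullary using (yes; no)

-- Congruences modulo m

module _ {m : ℕ} where

  ≋-refl : ∀ {x} → x ≋ x [mod m ]
  ≋-refl = 0 , 0 , refl

  ≋-reflexive : ∀ {x y} → x ≡ y → x ≋ y [mod m ]
  ≋-reflexive refl = ≋-refl

  ≋-sym : ∀ {x y} → x ≋ y [mod m ] → y ≋ x [mod m ]
  ≋-sym (i , j , eq) = j , i , sym eq

  private
    +-*-distribʳ-assoc : ∀ x i k m → x + (i + k) * m ≡ (x + i * m) + k * m
    +-*-distribʳ-assoc = solve-∀

    +-*-distrib-interchange : ∀ x u i k m → (x + u) + (i + k) * m ≡ (x + i * m) + (u + k * m)
    +-*-distrib-interchange = solve-∀

  ≋-trans : ∀ {x y z} → x ≋ y [mod m ] → y ≋ z [mod m ] → x ≋ z [mod m ]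
  ≋-trans {x} {y} {z} (i , j , x≈y) (k , l , y≈z) = i + k , l + j , (begin
    x + (i + k) * m      ≡⟨ +-*-distribʳ-assoc x i k m ⟩
    x + i * m + k * m    ≡⟨ cong (_+ k * m) x≈y ⟩
    y + j * m + k * m    ≡⟨ +-*-distribʳ-assoc y j k m ⟨
    y + (j + k) * m      ≡⟨ cong (λ c → y + c * m) (+-comm j k) ⟩
    y + (k + j) * m      ≡⟨ +-*-distribʳ-assoc y k j m ⟩
    y + k * m + j * m    ≡⟨ cong (_+ j * m) y≈z ⟩
    z + l * m + j * m    ≡⟨ +-*-distribʳ-assoc z l j m ⟨
    z + (l + j) * m      ∎)
    where open ≡-Reasoning

  ≋-+ : ∀ {x y u v} → x ≋ y [mod m ] → u ≋ v [mod m ] → x + u ≋ y + v [mod m ]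
  ≋-+ {x} {y} {u} {v} (i , j , x≈y) (k , l , u≈v) = i + k , j + l , (begin
    (x + u) + (i + k) * m      ≡⟨ +-*-distrib-interchange x u i k m ⟩
    (x + i * m) + (u + k * m)  ≡⟨ cong₂ _+_ x≈y u≈v ⟩
    (y + j * m) + (v + l * m)  ≡⟨ +-*-distrib-interchange y v j l m ⟨
    (y + v) + (j + l) * m      ∎)
    where open ≡-Reasoning

  ≋-*ˡ : ∀ c {x y} → x ≋ y [mod m ] → c * x ≋ c * y [mod m ]
  ≋-*ˡ c {x} {y} (i , j , x≈y) = c * i , c * j , (begin
    c * x + c * i * m  ≡⟨ distrib c x i ⟩
    c * (x + i * m)    ≡⟨ cong (c *_) x≈y ⟩
    c * (y + j * m)    ≡⟨ distrib c y j ⟨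
    c * y + c * j * m  ∎)
    where
      open ≡-Reasoning
      distrib : ∀ c x i → c * x + c * i * m ≡ c * (x + i * m)
      distrib c x i rewrite *-assoc c i m = sym (*-distribˡ-+ c x (i * m))

  ≋-*ʳ : ∀ c {x y} → x ≋ y [mod m ] → x * c ≋ y * c [mod m ]
  ≋-*ʳ c {x} {y} x≈y = subst₂ (λ a b → a ≋ b [mod m ]) (*-comm c x) (*-comm c y) (≋-*ˡ c x≈y)

  ≋⇒≡ : ∀ {x y} → x < m → y < m → x ≋ y [mod m ] → x ≡ y
  ≋⇒≡ {x} {y} x<m y<m (i , j , x≈y) = begin
    x                ≡⟨ m<n⇒m%n≡m x<m ⟨
    x % m            ≡⟨ [m+kn]%n≡m%n x i m ⟨
    (x + i * m) % m  ≡⟨ cong (_% m) x≈y ⟩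
    (y + j * m) % m  ≡⟨ [m+kn]%n≡m%n y j m ⟩
    y % m            ≡⟨ m<n⇒m%n≡m y<m ⟩
    y                ∎
    where
      open ≡-Reasoning
      instance
        m≢0 : NonZero m
        m≢0 = >-nonZero (<-≤-trans (s≤s z≤n) x<m)

≋-setoid : ℕ → Setoid 0ℓ 0ℓ
≋-setoid m = record
  { Carrier       = ℕ
  ; _≈_           = λ x y → x ≋ y [mod m ]
  ; isEquivalence = record { refl = ≋-refl ; sym = ≋-sym ; trans = ≋-trans }
  }

module ≋-Reasoning (m : ℕ) = Relation.Binary.Reasoning.Setoid (≋-setoid m)

inverse-involutive : ∀ {m x y z} → IsInvMod m x y → IsInvMod m y z → z ≋ x [mod m ]
inverse-involutive {m} {x} {y} {z} xy≋1 yz≋1 = begin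
  z              ≡⟨ +-identityʳ z ⟨
  1 * z          ≈⟨ ≋-*ʳ z xy≋1 ⟨
  x * y * z      ≡⟨ *-assoc x y z ⟩
  x * (y * z)    ≈⟨ ≋-*ˡ x yz≋1 ⟩
  x * 1          ≡⟨ *-identityʳ x ⟩
  x              ∎
  where open ≋-Reasoning m

2^k*x≋x : ∀ k x → 2 ^ k * x ≋ x [mod 2 ^ k ∸ 1 ]
2^k*x≋x k x = 0 , x , (begin
  2 ^ k * x + 0            ≡⟨ +-identityʳ _ ⟩
  2 ^ k * x                ≡⟨ cong (_* x) (m∸n+n≡m (m^n>0 2 k)) ⟨
  (2 ^ k ∸ 1 + 1) * x      ≡⟨ expand (2 ^ k ∸ 1) x ⟩
  x + x * (2 ^ k ∸ 1)      ∎)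
  where
    open ≡-Reasoning
    expand : ∀ m x → (m + 1) * x ≡ x + x * m
    expand = solve-∀

2^-injective : ∀ {x y} → 2 ^ x ≡ 2 ^ y → x ≡ y
2^-injective {x} {y} eq with <-cmp x y
... | tri< x<y _ _ = ⊥-elim (<-irrefl eq (^-monoʳ-< 2 (s≤s (s≤s z≤n)) x<y))
... | tri≈ _ x≡y _ = x≡y
... | tri> _ _ y<x = ⊥-elim (<-irrefl (sym eq) (^-monoʳ-< 2 (s≤s (s≤s z≤n)) y<x))

%-≡⇒∣ : ∀ a k n .{{_ : NonZero n}} → a % n ≡ (a + k) % n → n ∣ k
%-≡⇒∣ a k n eq = ∣m+n∣m⇒∣n (divides ((a + k) / n) (+-cancelˡ-≡ (a % n) _ _ (begin
  a % n + (a / n * n + k)        ≡⟨ +-assoc (a % n) _ k ⟨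
  a % n + a / n * n + k          ≡⟨ cong (_+ k) (m≡m%n+[m/n]*n a n) ⟨
  a + k                          ≡⟨ m≡m%n+[m/n]*n (a + k) n ⟩
  (a + k) % n + (a + k) / n * n  ≡⟨ cong (_+ (a + k) / n * n) eq ⟨
  a % n + (a + k) / n * n        ∎))) (n∣m*n (a / n))
  where open ≡-Reasoning

odd>1⇒3+2* : ∀ t → 1 < t → ¬ (2 ∣ t) → ∃[ q ] t ≡ 3 + 2 * q
odd>1⇒3+2* 1 (s≤s ()) _
odd>1⇒3+2* 2 _ 2∤t = ⊥-elim (2∤t ∣-refl)
odd>1⇒3+2* 3 _ _   = 0 , refl
odd>1⇒3+2* (suc (suc (suc (suc t)))) _ 2∤t
  with odd>1⇒3+2* (suc (suc t)) (s≤s (s≤s z≤n)) (2∤t ∘ ∣m∣n⇒∣m+n ∣-refl)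
... | q , eq = suc q , trans (cong (2 +_) eq) (shift q)
  where
    shift : ∀ q → 2 + (3 + 2 * q) ≡ 3 + 2 * suc q
    shift = solve-∀

+-suc-≡⇒< : ∀ {x y} k → x + suc k ≡ y → x < y
+-suc-≡⇒< {x} k refl = m<m+n x (s≤s z≤n)

e-shift : ∀ l k → e l k * 2 ^ k + 1 ≡ e l k + 2 ^ (l * k)
e-shift zero    k = refl
e-shift (suc l) k = begin
  (e l k + 2 ^ (l * k)) * 2 ^ k + 1          ≡⟨ regroup (e l k) (2 ^ (l * k)) (2 ^ k) ⟩
  (e l k * 2 ^ k + 1) + 2 ^ k * 2 ^ (l * k)  ≡⟨ cong₂ _+_ (e-shift l k) (sym (^-distribˡ-+-* 2 k (l * k))) ⟩
  e l k + 2 ^ (l * k) + 2 ^ (suc l * k)      ∎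
  where
    open ≡-Reasoning
    regroup : ∀ x a b → (x + a) * b + 1 ≡ (x * b + 1) + b * a
    regroup = solve-∀

-- Binary words and their rotations

private
  ¬T⇒≡false : ∀ {b} → ¬ T b → b ≡ false
  ¬T⇒≡false {false} _    = refl
  ¬T⇒≡false {true}  ¬T⊤ = ⊥-elim (¬T⊤ _)

<ᵇ-true : ∀ {i a} → i < a → (i <ᵇ a) ≡ true
<ᵇ-true i<a = Equivalence.to T-≡ (<⇒<ᵇ i<a)

<ᵇ-false : ∀ {i a} → a ≤ i → (i <ᵇ a) ≡ false
<ᵇ-false {i} {a} a≤i = ¬T⇒≡false (λ i<ᵇa → <⇒≱ (<ᵇ⇒< i a i<ᵇa) a≤i)

≡ᵇ-refl : ∀ i → (i ≡ᵇ i) ≡ true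
≡ᵇ-refl i = Equivalence.to T-≡ (≡⇒≡ᵇ i i refl)

≡ᵇ-false : ∀ {i j} → i ≢ j → (i ≡ᵇ j) ≡ false
≡ᵇ-false {i} {j} i≢j = ¬T⇒≡false (λ i≡ᵇj → i≢j (≡ᵇ⇒≡ i j i≡ᵇj))

bit-clash : ∀ {x} → x ≡ true → x ≡ false → ⊥
bit-clash refl ()

bit : Bool → ℕ
bit false = 0
bit true  = 1

bit≤1 : ∀ b → bit b ≤ 1
bit≤1 false = z≤n
bit≤1 true  = ≤-refl

fromBits : ℕ → (ℕ → Bool) → ℕ
fromBits zero    f = 0
fromBits (suc k) f = fromBits k f + bit (f k) * 2 ^ k

fromBits-cong : ∀ k {f g} → (∀ i → i < k → f i ≡ g i) → fromBits k f ≡ fromBits k g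
fromBits-cong zero    f≗g = refl
fromBits-cong (suc k) f≗g =
  cong₂ _+_ (fromBits-cong k (λ i i<k → f≗g i (m<n⇒m<1+n i<k)))
            (cong (λ b → bit b * 2 ^ k) (f≗g k (n<1+n k)))

fromBits<2^ : ∀ k f → fromBits k f < 2 ^ k
fromBits<2^ zero    f = s≤s z≤n
fromBits<2^ (suc k) f = begin-strict
  fromBits k f + bit (f k) * 2 ^ k  <⟨ +-mono-<-≤ (fromBits<2^ k f) (*-monoˡ-≤ (2 ^ k) (bit≤1 (f k))) ⟩
  2 ^ k + 1 * 2 ^ k                 ≡⟨ cong (2 ^ k +_) (*-identityˡ (2 ^ k)) ⟩
  2 ^ k + 2 ^ k                     ≡⟨ cong (2 ^ k +_) (+-identityʳ (2 ^ k)) ⟨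
  2 ^ suc k                         ∎
  where open ≤-Reasoning

private
  2^k≤x+2^k : ∀ x k → 2 ^ k ≤ x + bit true * 2 ^ k
  2^k≤x+2^k x k = ≤-trans (≤-reflexive (sym (*-identityˡ (2 ^ k)))) (m≤n+m (1 * 2 ^ k) x)

  top-bit-injective : ∀ {x y} k b c → x < 2 ^ k → y < 2 ^ k →
                      x + bit b * 2 ^ k ≡ y + bit c * 2 ^ k → b ≡ c × x ≡ y
  top-bit-injective {x} {y} k false false _ _ eq = refl , +-cancelʳ-≡ 0 x y eq
  top-bit-injective {x} {y} k true  true  _ _ eq = refl , +-cancelʳ-≡ (1 * 2 ^ k) x y eq
  top-bit-injective {x} {y} k true  false _ y<2^k eq =
    ⊥-elim (<⇒≱ y<2^k (subst (2 ^ k ≤_) (trans eq (+-identityʳ y)) (2^k≤x+2^k x k)))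
  top-bit-injective {x} {y} k false true x<2^k _ eq =
    ⊥-elim (<⇒≱ x<2^k (subst (2 ^ k ≤_) (trans (sym eq) (+-identityʳ x)) (2^k≤x+2^k y k)))

fromBits-injective : ∀ k {f g} → fromBits k f ≡ fromBits k g → ∀ i → i < k → f i ≡ g i
fromBits-injective (suc k) {f} {g} eq i i<1+k
  with top-bit-injective k (f k) (g k) (fromBits<2^ k f) (fromBits<2^ k g) eq
     | m<1+n⇒m<n∨m≡n i<1+k
... | _       , eq′ | inj₁ i<k  = fromBits-injective k eq′ i i<k
... | fk≡gk   , _   | inj₂ refl = fk≡gk

fromBits-+ : ∀ a k f → fromBits (a + k) f ≡ fromBits a f + 2 ^ a * fromBits k (λ i → f (a + i))
fromBits-+ a zero f rewrite +-identityʳ a | *-zeroʳ (2 ^ a) = sym (+-identityʳ _)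
fromBits-+ a (suc k) f rewrite +-suc a k | fromBits-+ a k f | ^-distribˡ-+-* 2 a k =
  regroup (fromBits a f) (2 ^ a) (fromBits k (λ i → f (a + i))) (bit (f (a + k))) (2 ^ k)
  where
    regroup : ∀ x p y z q → (x + p * y) + z * (p * q) ≡ x + p * (y + z * q)
    regroup = solve-∀

rotateIndex : ℕ → ℕ → ℕ → ℕ
rotateIndex v w i = if i <ᵇ v then w + i else i ∸ v

fromBits-rotate : ∀ v w f → fromBits (v + w) (λ i → f (rotateIndex v w i))
                            ≡ fromBits v (λ i → f (w + i)) + 2 ^ v * fromBits w f
fromBits-rotate v w f = trans (fromBits-+ v w _)
  (cong₂ (λ x y → x + 2 ^ v * y)
    (fromBits-cong v (λ i i<v → cong (λ b → f (if b then w + i else i ∸ v)) (<ᵇ-true i<v)))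
    (fromBits-cong w (λ i _ → cong f (trans (cong (λ b → if b then w + (v + i) else v + i ∸ v)
                                                  (<ᵇ-false (m≤m+n v i)))
                                            (m+n∸m≡n v i)))))

rotate-≋ : ∀ v w f → fromBits (v + w) (λ i → f (rotateIndex v w i))
                     ≋ 2 ^ v * fromBits (w + v) f [mod 2 ^ (v + w) ∸ 1 ]
rotate-≋ v w f = begin
  fromBits (v + w) (λ i → f (rotateIndex v w i)) ≡⟨ fromBits-rotate v w f ⟩
  high + 2 ^ v * low                             ≡⟨ +-comm high _ ⟩
  2 ^ v * low + high                             ≈⟨ ≋-+ ≋-refl (2^k*x≋x (v + w) high) ⟨
  2 ^ v * low + 2 ^ (v + w) * high               ≡⟨ split ⟨
  2 ^ v * fromBits (w + v) f                     ∎
  where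
    open ≋-Reasoning (2 ^ (v + w) ∸ 1)
    high = fromBits v (λ i → f (w + i))
    low  = fromBits w f
    split : 2 ^ v * fromBits (w + v) f ≡ 2 ^ v * low + 2 ^ (v + w) * high
    split rewrite fromBits-+ w v f | ^-distribˡ-+-* 2 v w =
      trans (*-distribˡ-+ (2 ^ v) low _) (cong (2 ^ v * low +_) (sym (*-assoc (2 ^ v) (2 ^ w) high)))

fromBits-<ᵇ-all : ∀ k a → k ≤ a → fromBits k (_<ᵇ a) + 1 ≡ 2 ^ k
fromBits-<ᵇ-all zero    a _   = refl
fromBits-<ᵇ-all (suc k) a k<a rewrite <ᵇ-true {k} {a} k<a = begin
  fromBits k (_<ᵇ a) + 1 * 2 ^ k + 1    ≡⟨ regroup (fromBits k (_<ᵇ a)) (2 ^ k) ⟩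
  (fromBits k (_<ᵇ a) + 1) + 2 ^ k + 0  ≡⟨ cong (λ x → x + 2 ^ k + 0) (fromBits-<ᵇ-all k a (<⇒≤ k<a)) ⟩
  2 ^ k + 2 ^ k + 0                     ≡⟨ +-assoc (2 ^ k) (2 ^ k) 0 ⟩
  2 ^ suc k                             ∎
  where
    open ≡-Reasoning
    regroup : ∀ x p → x + 1 * p + 1 ≡ (x + 1) + p + 0
    regroup = solve-∀

fromBits-<ᵇ : ∀ k a → a ≤ k → fromBits k (_<ᵇ a) + 1 ≡ 2 ^ a
fromBits-<ᵇ zero    zero _ = refl
fromBits-<ᵇ (suc k) a a≤1+k with m≤n⇒m<n∨m≡n a≤1+k
... | inj₂ refl   = fromBits-<ᵇ-all (suc k) (suc k) ≤-refl
... | inj₁ a<1+k rewrite <ᵇ-false {k} {a} (≤-pred a<1+k) =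
  trans (cong (_+ 1) (+-identityʳ _)) (fromBits-<ᵇ k a (≤-pred a<1+k))

fromBits-set : ∀ k f p → p < k → f p ≡ false →
               fromBits k (λ i → f i ∨ (i ≡ᵇ p)) ≡ fromBits k f + 2 ^ p
fromBits-set (suc k) f p p<1+k fp≡false with m<1+n⇒m<n∨m≡n p<1+k
... | inj₁ p<k rewrite ≡ᵇ-false {k} {p} (>⇒≢ p<k) | ∨-identityʳ (f k) | fromBits-set k f p p<k fp≡false =
  xy∙z≈xz∙y (fromBits k f) (2 ^ p) (bit (f k) * 2 ^ k)
... | inj₂ refl rewrite ≡ᵇ-refl p | fp≡false =
  trans (cong₂ _+_ (fromBits-cong p (λ i i<p → trans (cong (f i ∨_) (≡ᵇ-false (<⇒≢ i<p))) (∨-identityʳ (f i))))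
                   (+-identityʳ (2 ^ p)))
        (cong (_+ 2 ^ p) (sym (+-identityʳ (fromBits p f))))

module Niho (q : ℕ) where

  t s n : ℕ
  t = 3 + 2 * q
  s = 5 + 3 * q
  n = 2 * t + 1

  [3t+1]/2≡s : (3 * t + 1) / 2 ≡ s
  [3t+1]/2≡s = trans (cong (_/ 2) (identity q)) (m*n/n≡m s 2)
    where
      identity : ∀ q → 3 * (3 + 2 * q) + 1 ≡ (5 + 3 * q) * 2
      identity = solve-∀

  n≡1+t+t : n ≡ suc (t + t)
  n≡1+t+t = identity q
    where
      identity : ∀ q → 2 * (3 + 2 * q) + 1 ≡ suc ((3 + 2 * q) + (3 + 2 * q))
      identity = solve-∀

  t+[2+q]≡s : t + (2 + q) ≡ s
  t+[2+q]≡s = identity q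
    where
      identity : ∀ q → (3 + 2 * q) + (2 + q) ≡ 5 + 3 * q
      identity = solve-∀

  [2+q]+s≡n : 2 + q + s ≡ n
  [2+q]+s≡n = identity q
    where
      identity : ∀ q → 2 + q + (5 + 3 * q) ≡ 2 * (3 + 2 * q) + 1
      identity = solve-∀

  [2+q]+[1+q]≡t : 2 + q + suc q ≡ t
  [2+q]+[1+q]≡t = identity q
    where
      identity : ∀ q → 2 + q + suc q ≡ 3 + 2 * q
      identity = solve-∀

  1+t<s : suc t < s
  1+t<s = +-suc-≡⇒< q (identity q)
    where
      identity : ∀ q → suc (3 + 2 * q) + suc q ≡ 5 + 3 * q
      identity = solve-∀

  1+s<n : suc s < n
  1+s<n = +-suc-≡⇒< q (identity q)
    where
      identity : ∀ q → suc (5 + 3 * q) + suc q ≡ 2 * (3 + 2 * q) + 1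
      identity = solve-∀

  s<t+t : s < t + t
  s<t+t = +-suc-≡⇒< q (identity q)
    where
      identity : ∀ q → 5 + 3 * q + suc q ≡ (3 + 2 * q) + (3 + 2 * q)
      identity = solve-∀

  t<s : t < s
  t<s = <-trans (n<1+n t) 1+t<s

  s<n : s < n
  s<n = <-trans (n<1+n s) 1+s<n

  1+t<n : suc t < n
  1+t<n = <-trans 1+t<s s<n

  t<n : t < n
  t<n = <-trans (n<1+n t) 1+t<n

  2+q<t : 2 + q < t
  2+q<t = +-suc-≡⇒< q [2+q]+[1+q]≡t

  t+t<n : t + t < n
  t+t<n = ≤-reflexive (sym n≡1+t+t)

  <n⇒≤t+t : ∀ {x} → x < n → x ≤ t + t
  <n⇒≤t+t {x} x<n = ≤-pred (subst (x <_) n≡1+t+t x<n)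

  n∸[1+t]≡t : n ∸ suc t ≡ t
  n∸[1+t]≡t = trans (cong (_∸ suc t) n≡1+t+t) (m+n∸m≡n (suc t) t)

  M d : ℕ
  M = 2 ^ n ∸ 1
  d = 2 ^ t + 2 ^ s ∸ 1

  nihoExp≡d : nihoExp t ≡ d
  nihoExp≡d = cong (λ z → 2 ^ t + 2 ^ z ∸ 1) [3t+1]/2≡s

  d+1≡2^t+2^s : d + 1 ≡ 2 ^ t + 2 ^ s
  d+1≡2^t+2^s = m∸n+n≡m (≤-trans (m^n>0 2 t) (m≤m+n (2 ^ t) (2 ^ s)))

  2^n≡1+M : 2 ^ n ≡ suc M
  2^n≡1+M = trans (sym (m∸n+n≡m (m^n>0 2 n))) (+-comm M 1)

  0<M : 0 < M
  0<M = m<n⇒0<n∸m (^-monoʳ-< 2 (s≤s (s≤s z≤n)) {0} {n} (s≤s z≤n))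

  2^[r+kn]≋2^r : ∀ r k → 2 ^ (r + k * n) ≋ 2 ^ r [mod M ]
  2^[r+kn]≋2^r r zero    = ≋-reflexive (cong (2 ^_) (+-identityʳ r))
  2^[r+kn]≋2^r r (suc k) = ≋-trans (≋-reflexive 2^[r+n+kn]) (≋-trans (2^k*x≋x n _) (2^[r+kn]≋2^r r k))
    where
      2^[r+n+kn] : 2 ^ (r + suc k * n) ≡ 2 ^ n * 2 ^ (r + k * n)
      2^[r+n+kn] = trans (cong (2 ^_) (x∙yz≈y∙xz r n (k * n))) (^-distribˡ-+-* 2 n (r + k * n))

  2^u≋2^[u%n] : ∀ u → 2 ^ u ≋ 2 ^ (u % n) [mod M ]
  2^u≋2^[u%n] u = ≋-trans (≋-reflexive (cong (2 ^_) (m≡m%n+[m/n]*n u n))) (2^[r+kn]≋2^r (u % n) (u / n))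

  2^[an]*x≋x : ∀ a x → 2 ^ (a * n) * x ≋ x [mod M ]
  2^[an]*x≋x a x = ≋-trans (≋-*ʳ x (2^[r+kn]≋2^r 0 a)) (≋-reflexive (+-identityʳ x))

  -- The binary digits of d + 2 ^ a: d has ones at [0, t) and s, and adding 2 ^ a carries
  -- only when a < t or a = s.
  lowDigits : ℕ → ℕ → Bool
  lowDigits a i = ((i <ᵇ a) ∨ (i ≡ᵇ t)) ∨ (i ≡ᵇ s)

  carryDigits : ℕ → Bool
  carryDigits i = (i <ᵇ t) ∨ (i ≡ᵇ suc s)

  highDigits : ℕ → ℕ → Bool
  highDigits a i = ((i <ᵇ t) ∨ (i ≡ᵇ s)) ∨ (i ≡ᵇ a)

  digits : ℕ → ℕ → Bool
  digits a with a <ᵇ t | a ≡ᵇ s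
  ... | true  | _     = lowDigits a
  ... | false | true  = carryDigits
  ... | false | false = highDigits a

  digits-low : ∀ {a} → a < t → ∀ i → digits a i ≡ lowDigits a i
  digits-low a<t i rewrite <ᵇ-true a<t = refl

  digits-carry : ∀ i → digits s i ≡ carryDigits i
  digits-carry i rewrite <ᵇ-false (<⇒≤ t<s) | ≡ᵇ-refl s = refl

  digits-high : ∀ {a} → t ≤ a → a ≢ s → ∀ i → digits a i ≡ highDigits a i
  digits-high t≤a a≢s i rewrite <ᵇ-false t≤a | ≡ᵇ-false a≢s = refl

  lowDigits-< : ∀ {a i} → i < a → lowDigits a i ≡ true
  lowDigits-< i<a rewrite <ᵇ-true i<a = refl

  lowDigits-t : ∀ a → lowDigits a t ≡ true
  lowDigits-t a rewrite ≡ᵇ-refl t | ∨-zeroʳ (t <ᵇ a) = refl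

  lowDigits-other : ∀ {a i} → a ≤ i → i ≢ t → i ≢ s → lowDigits a i ≡ false
  lowDigits-other a≤i i≢t i≢s rewrite <ᵇ-false a≤i | ≡ᵇ-false i≢t | ≡ᵇ-false i≢s = refl

  carryDigits-< : ∀ {i} → i < t → carryDigits i ≡ true
  carryDigits-< i<t rewrite <ᵇ-true i<t = refl

  carryDigits-other : ∀ {i} → t ≤ i → i ≢ suc s → carryDigits i ≡ false
  carryDigits-other t≤i i≢1+s rewrite <ᵇ-false t≤i | ≡ᵇ-false i≢1+s = refl

  highDigits-< : ∀ {a i} → i < t → highDigits a i ≡ true
  highDigits-< i<t rewrite <ᵇ-true i<t = refl

  highDigits-s : ∀ a → highDigits a s ≡ true
  highDigits-s a rewrite ≡ᵇ-refl s | ∨-zeroʳ (s <ᵇ t) = refl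

  highDigits-other : ∀ {a i} → t ≤ i → i ≢ s → i ≢ a → highDigits a i ≡ false
  highDigits-other t≤i i≢s i≢a rewrite <ᵇ-false t≤i | ≡ᵇ-false i≢s | ≡ᵇ-false i≢a = refl

  digits-< : ∀ {a i} → t ≤ a → i < t → digits a i ≡ true
  digits-< {a} {i} t≤a i<t with a ≟ s
  ... | yes refl = trans (digits-carry i) (carryDigits-< i<t)
  ... | no a≢s   = trans (digits-high t≤a a≢s i) (highDigits-< i<t)

  private
    regroup : ∀ x y z → x + y + z + 1 ≡ (x + 1) + y + z
    regroup = solve-∀

  lowDigits-value : ∀ {a} → a < t → fromBits n (lowDigits a) + 1 ≡ 2 ^ t + 2 ^ s + 2 ^ a
  lowDigits-value {a} a<t = begin
    fromBits n (lowDigits a) + 1                         ≡⟨ cong (_+ 1) (fromBits-set n _ s s<n s∉) ⟩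
    fromBits n (λ i → (i <ᵇ a) ∨ (i ≡ᵇ t)) + 2 ^ s + 1  ≡⟨ cong (λ x → x + 2 ^ s + 1) (fromBits-set n _ t t<n (<ᵇ-false (<⇒≤ a<t))) ⟩
    fromBits n (_<ᵇ a) + 2 ^ t + 2 ^ s + 1              ≡⟨ regroup (fromBits n (_<ᵇ a)) (2 ^ t) (2 ^ s) ⟩
    (fromBits n (_<ᵇ a) + 1) + 2 ^ t + 2 ^ s            ≡⟨ cong (λ x → x + 2 ^ t + 2 ^ s) (fromBits-<ᵇ n a (<⇒≤ (<-trans a<t t<n))) ⟩
    2 ^ a + 2 ^ t + 2 ^ s                                ≡⟨ xy∙z≈yz∙x (2 ^ a) (2 ^ t) (2 ^ s) ⟩
    2 ^ t + 2 ^ s + 2 ^ a                                ∎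
    where
      open ≡-Reasoning
      s∉ : ((s <ᵇ a) ∨ (s ≡ᵇ t)) ≡ false
      s∉ rewrite <ᵇ-false (<⇒≤ (<-trans a<t t<s)) | ≡ᵇ-false (>⇒≢ t<s) = refl

  carryDigits-value : fromBits n carryDigits + 1 ≡ 2 ^ t + 2 ^ s + 2 ^ s
  carryDigits-value = begin
    fromBits n carryDigits + 1                    ≡⟨ cong (_+ 1) (fromBits-set n _ (suc s) 1+s<n (<ᵇ-false (<⇒≤ (<-trans t<s (n<1+n s))))) ⟩
    fromBits n (_<ᵇ t) + 2 ^ suc s + 1            ≡⟨ regroup′ (fromBits n (_<ᵇ t)) (2 ^ s) ⟩
    (fromBits n (_<ᵇ t) + 1) + 2 ^ s + 2 ^ s      ≡⟨ cong (λ x → x + 2 ^ s + 2 ^ s) (fromBits-<ᵇ n t (<⇒≤ t<n)) ⟩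
    2 ^ t + 2 ^ s + 2 ^ s                         ∎
    where
      open ≡-Reasoning
      regroup′ : ∀ x y → x + 2 * y + 1 ≡ (x + 1) + y + y
      regroup′ = solve-∀

  highDigits-value : ∀ {a} → t ≤ a → a ≢ s → a < n → fromBits n (highDigits a) + 1 ≡ 2 ^ t + 2 ^ s + 2 ^ a
  highDigits-value {a} t≤a a≢s a<n = begin
    fromBits n (highDigits a) + 1                        ≡⟨ cong (_+ 1) (fromBits-set n _ a a<n a∉) ⟩
    fromBits n (λ i → (i <ᵇ t) ∨ (i ≡ᵇ s)) + 2 ^ a + 1  ≡⟨ cong (λ x → x + 2 ^ a + 1) (fromBits-set n _ s s<n (<ᵇ-false (<⇒≤ t<s))) ⟩
    fromBits n (_<ᵇ t) + 2 ^ s + 2 ^ a + 1              ≡⟨ regroup (fromBits n (_<ᵇ t)) (2 ^ s) (2 ^ a) ⟩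
    (fromBits n (_<ᵇ t) + 1) + 2 ^ s + 2 ^ a            ≡⟨ cong (λ x → x + 2 ^ s + 2 ^ a) (fromBits-<ᵇ n t (<⇒≤ t<n)) ⟩
    2 ^ t + 2 ^ s + 2 ^ a                                ∎
    where
      open ≡-Reasoning
      a∉ : ((a <ᵇ t) ∨ (a ≡ᵇ s)) ≡ false
      a∉ rewrite <ᵇ-false t≤a | ≡ᵇ-false a≢s = refl

  digits-value+1 : ∀ a → a < n → fromBits n (digits a) + 1 ≡ 2 ^ t + 2 ^ s + 2 ^ a
  digits-value+1 a a<n with a <? t | a ≟ s
  ... | yes a<t | _        = trans (cong (_+ 1) (fromBits-cong n (λ i _ → digits-low a<t i))) (lowDigits-value a<t)
  ... | no _    | yes refl = trans (cong (_+ 1) (fromBits-cong n (λ i _ → digits-carry i))) carryDigits-value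
  ... | no a≮t  | no a≢s   = trans (cong (_+ 1) (fromBits-cong n (λ i _ → digits-high (≮⇒≥ a≮t) a≢s i)))
                                   (highDigits-value (≮⇒≥ a≮t) a≢s a<n)

  digits-value : ∀ a → a < n → fromBits n (digits a) ≡ d + 2 ^ a
  digits-value a a<n = +-cancelʳ-≡ 1 _ _ (begin
    fromBits n (digits a) + 1  ≡⟨ digits-value+1 a a<n ⟩
    2 ^ t + 2 ^ s + 2 ^ a      ≡⟨ cong (_+ 2 ^ a) d+1≡2^t+2^s ⟨
    d + 1 + 2 ^ a              ≡⟨ xy∙z≈xz∙y d 1 (2 ^ a) ⟩
    d + 2 ^ a + 1              ∎)
    where open ≡-Reasoning

  2^t+2^s+2^a<2^n : ∀ {a} → a < n → 2 ^ t + 2 ^ s + 2 ^ a < 2 ^ n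
  2^t+2^s+2^a<2^n {a} a<n = begin-strict
    2 ^ t + 2 ^ s + 2 ^ a            <⟨ +-mono-<-≤ 2^t+2^s<2^[t+t] (^-monoʳ-≤ 2 (<n⇒≤t+t a<n)) ⟩
    2 ^ (t + t) + 2 ^ (t + t)        ≡⟨ cong (2 ^ (t + t) +_) (+-identityʳ _) ⟨
    2 ^ suc (t + t)                  ≡⟨ cong (2 ^_) n≡1+t+t ⟨
    2 ^ n                            ∎
    where
      open ≤-Reasoning
      2^t+2^s<2^[t+t] : 2 ^ t + 2 ^ s < 2 ^ (t + t)
      2^t+2^s<2^[t+t] = begin-strict
        2 ^ t + 2 ^ s      <⟨ +-monoˡ-< (2 ^ s) (^-monoʳ-< 2 (s≤s (s≤s z≤n)) t<s) ⟩
        2 ^ s + 2 ^ s      ≡⟨ cong (2 ^ s +_) (+-identityʳ _) ⟨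
        2 ^ suc s          ≤⟨ ^-monoʳ-≤ 2 s<t+t ⟩
        2 ^ (t + t)        ∎

  d+2^a<M : ∀ {a} → a < n → d + 2 ^ a < M
  d+2^a<M {a} a<n = +-cancelʳ-< 1 _ M (begin-strict
    d + 2 ^ a + 1          ≡⟨ xy∙z≈xz∙y d (2 ^ a) 1 ⟩
    d + 1 + 2 ^ a          ≡⟨ cong (_+ 2 ^ a) d+1≡2^t+2^s ⟩
    2 ^ t + 2 ^ s + 2 ^ a  <⟨ 2^t+2^s+2^a<2^n a<n ⟩
    2 ^ n                  ≡⟨ trans 2^n≡1+M (+-comm 1 M) ⟩
    M + 1                  ∎)
    where open ≤-Reasoning

  rot : ℕ → ℕ → ℕ
  rot u = rotateIndex u (n ∸ u)

  record Rotated (x y : ℕ → Bool) (u : ℕ) : Set where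
    constructor mkRotated
    field at : ∀ i → i < n → x i ≡ y (rot u i)

  rot-≥ : ∀ {u i} → u ≤ i → rot u i ≡ i ∸ u
  rot-≥ u≤i rewrite <ᵇ-false u≤i = refl

  rot-< : ∀ {u i} → i < u → rot u i ≡ n ∸ u + i
  rot-< i<u rewrite <ᵇ-true i<u = refl

  rot-+ : ∀ {u i} k → u + k ≡ i → rot u i ≡ k
  rot-+ {u} k refl = trans (rot-≥ (m≤m+n u k)) (m+n∸m≡n u k)

  rotated-sym : ∀ {x y u} → u < n → Rotated x y u → Rotated y x (n ∸ u)
  rotated-sym {x} {y} {u} u<n (mkRotated x≈y) = mkRotated y≈x
    where
      y≈x : ∀ j → j < n → y j ≡ x (rot (n ∸ u) j)
      y≈x j j<n with j <? n ∸ u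
      ... | yes j<n∸u = begin
        y j                    ≡⟨ cong y (rot-+ {u} j refl) ⟨
        y (rot u (u + j))      ≡⟨ x≈y (u + j) u+j<n ⟨
        x (u + j)              ≡⟨ cong (λ i → x (i + j)) (m∸[m∸n]≡n (<⇒≤ u<n)) ⟨
        x (n ∸ (n ∸ u) + j)    ≡⟨ cong x (rot-< j<n∸u) ⟨
        x (rot (n ∸ u) j)      ∎
        where
          open ≡-Reasoning
          u+j<n : u + j < n
          u+j<n = subst (u + j <_) (m+[n∸m]≡n (<⇒≤ u<n)) (+-monoʳ-< u j<n∸u)
      ... | no j≮n∸u = begin
        y j                    ≡⟨ cong y (trans (rot-< i<u) n∸u+i≡j) ⟨
        y (rot u i)            ≡⟨ x≈y i (<-trans i<u u<n) ⟨
        x i                    ≡⟨ cong x (rot-≥ (≮⇒≥ j≮n∸u)) ⟨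
        x (rot (n ∸ u) j)      ∎
        where
          open ≡-Reasoning
          i = j ∸ (n ∸ u)
          n∸u+i≡j : n ∸ u + i ≡ j
          n∸u+i≡j = m+[n∸m]≡n (≮⇒≥ j≮n∸u)
          i<u : i < u
          i<u = +-cancelˡ-< (n ∸ u) i u (subst₂ _<_ (sym n∸u+i≡j) (sym (m∸n+n≡m (<⇒≤ u<n))) j<n)

  rotated-at : ∀ {x y u i} k → Rotated x y u → i < n → u + k ≡ i → x i ≡ y k
  rotated-at {y = y} k (mkRotated x≈y) i<n u+k≡i = trans (x≈y _ i<n) (cong y (rot-+ k u+k≡i))

  digits-∋t : ∀ {b} → digits b t ≡ true → b < t ⊎ b ≡ t
  digits-∋t {b} b∋t with b <? t | b ≟ s
  ... | yes b<t | _        = inj₁ b<t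
  ... | no _    | yes refl = ⊥-elim (bit-clash b∋t (trans (digits-carry t) (carryDigits-other ≤-refl (<⇒≢ (<-trans t<s (n<1+n s))))))
  ... | no b≮t  | no b≢s with b ≟ t
  ...   | yes b≡t = inj₂ b≡t
  ...   | no b≢t  = ⊥-elim (bit-clash b∋t (trans (digits-high (≮⇒≥ b≮t) b≢s t) (highDigits-other ≤-refl (<⇒≢ t<s) (b≢t ∘ sym))))

  digits-t∌s : ∀ i → t ≤ i → i ≢ t → i ≢ s → digits t i ≡ false
  digits-t∌s i t≤i i≢t i≢s = trans (digits-high ≤-refl (<⇒≢ t<s) i) (highDigits-other t≤i i≢s i≢t)

  ¬digits-t∧1+t : ∀ {b} → digits b t ≡ true → digits b (suc t) ≡ true → ⊥
  ¬digits-t∧1+t {b} b∋t b∋1+t with digits-∋t {b} b∋t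
  ... | inj₁ b<t  = bit-clash b∋1+t (trans (digits-low b<t (suc t))
                      (lowDigits-other (≤-trans (<⇒≤ b<t) (n≤1+n t)) (>⇒≢ (n<1+n t)) (<⇒≢ 1+t<s)))
  ... | inj₂ refl = bit-clash b∋1+t (digits-t∌s (suc t) (n≤1+n t) (>⇒≢ (n<1+n t)) (<⇒≢ 1+t<s))

  digits-∋pred-s : ∀ {a} → t ≤ a → digits a (pred s) ≡ true → a ≡ pred s
  digits-∋pred-s {a} t≤a a∋pred-s with a ≟ s | a ≟ pred s
  ... | yes refl | _             = ⊥-elim (bit-clash a∋pred-s
      (trans (digits-carry (pred s)) (carryDigits-other (≤-pred t<s) (<⇒≢ (<-trans (n<1+n (pred s)) (n<1+n s))))))
  ... | no _     | yes a≡pred-s = a≡pred-s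
  ... | no a≢s   | no a≢pred-s  = ⊥-elim (bit-clash a∋pred-s
      (trans (digits-high t≤a a≢s (pred s)) (highDigits-other (≤-pred t<s) (<⇒≢ (n<1+n _)) (a≢pred-s ∘ sym))))

  ¬rotated-t-by-1 : ∀ {a} → t ≤ a → ¬ Rotated (digits t) (digits a) 1
  ¬rotated-t-by-1 {a} t≤a t≈a = bit-clash (trans (rotated-at s t≈a 1+s<n refl) a∋s)
    (digits-t∌s (suc s) (≤-trans (<⇒≤ t<s) (n≤1+n s)) (>⇒≢ (<-trans t<s (n<1+n s))) (>⇒≢ (n<1+n s)))
    where
      a∋pred-s : digits a (pred s) ≡ true
      a∋pred-s = trans (sym (rotated-at (pred s) t≈a s<n refl)) (trans (digits-high ≤-refl (<⇒≢ t<s) s) (highDigits-s t))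
      a∋s : digits a s ≡ true
      a∋s = subst (λ a → digits a s ≡ true) (sym (digits-∋pred-s t≤a a∋pred-s))
                  (trans (digits-high (≤-pred t<s) (<⇒≢ (n<1+n (pred s))) s) (highDigits-s (pred s)))

  ¬rotated-high-by-1 : ∀ {a b} → t ≤ a → ¬ Rotated (digits b) (digits a) 1
  ¬rotated-high-by-1 {a} {b} t≤a b≈a = by-shape (digits-∋t {b} b∋t)
    where
      b∋t : digits b t ≡ true
      b∋t = trans (rotated-at (pred t) b≈a t<n refl) (digits-< t≤a (n<1+n (pred t)))
      by-shape : b < t ⊎ b ≡ t → ⊥
      by-shape (inj₁ b<t) = bit-clash
        (trans (rotated-at (pred (pred t)) b≈a (<-trans (n<1+n (pred t)) t<n) refl)
               (digits-< t≤a (<-trans (n<1+n _) (n<1+n (pred t)))))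
        (trans (digits-low b<t (pred t))
               (lowDigits-other (≤-pred b<t) (<⇒≢ (n<1+n (pred t))) (<⇒≢ (<-trans (n<1+n (pred t)) t<s))))
      by-shape (inj₂ b≡t) = ¬rotated-t-by-1 t≤a (subst (λ b → Rotated (digits b) (digits a) 1) b≡t b≈a)

  ¬rotated-high-short : ∀ {a b u} → t ≤ a → 1 ≤ u → u ≤ t → ¬ Rotated (digits b) (digits a) u
  ¬rotated-high-short {a} {b} {u} t≤a 1≤u u≤t b≈a with u ≟ 1
  ... | yes refl = ¬rotated-high-by-1 {a} {b} t≤a b≈a
  ... | no u≢1   = ¬digits-t∧1+t {b} b∋t b∋1+t
    where
      u+[t∸u]≡t : u + (t ∸ u) ≡ t
      u+[t∸u]≡t = m+[n∸m]≡n u≤t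
      b∋t : digits b t ≡ true
      b∋t = trans (rotated-at (t ∸ u) b≈a t<n u+[t∸u]≡t) (digits-< t≤a (∸-monoʳ-< {t} {u} {0} 1≤u u≤t))
      b∋1+t : digits b (suc t) ≡ true
      b∋1+t = trans (rotated-at (suc (t ∸ u)) b≈a 1+t<n (trans (+-suc u _) (cong suc u+[t∸u]≡t)))
                    (digits-< t≤a (s≤s (∸-monoʳ-< {t} {u} {1} (≤∧≢⇒< 1≤u (u≢1 ∘ sym)) u≤t)))

  ¬rotated-high-long : ∀ {a b u} → t ≤ a → t < u → u < n → ¬ Rotated (digits b) (digits a) u
  ¬rotated-high-long {a} {b} {u} t≤a t<u u<n b≈a with t ≤? b
  ... | yes t≤b = ¬rotated-high-short {b} {a} t≤b (m<n⇒0<n∸m u<n) n∸u≤t (rotated-sym u<n b≈a)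
    where
      n∸u≤t : n ∸ u ≤ t
      n∸u≤t = ≤-trans (∸-monoʳ-≤ n t<u) (≤-reflexive n∸[1+t]≡t)
  ... | no t≰b = bit-clash
      (trans (rotated-at (t + t ∸ u) b≈a t+t<n (m+[n∸m]≡n (<n⇒≤t+t u<n))) (digits-< t≤a t+t∸u<t))
      (trans (digits-low b<t (t + t))
             (lowDigits-other (≤-trans (<⇒≤ b<t) (m≤m+n t t)) (>⇒≢ (m<m+n t (s≤s z≤n))) (>⇒≢ s<t+t)))
    where
      b<t : b < t
      b<t = ≰⇒> t≰b
      t+t∸u<t : t + t ∸ u < t
      t+t∸u<t = subst (t + t ∸ u <_) (m+n∸m≡n t t) (∸-monoʳ-< t<u (<n⇒≤t+t u<n))

  ¬rotated-high : ∀ {a b u} → t ≤ a → 1 ≤ u → u < n → ¬ Rotated (digits b) (digits a) u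
  ¬rotated-high {a} {b} {u} t≤a 1≤u u<n with u ≤? t
  ... | yes u≤t = ¬rotated-high-short {a} {b} t≤a 1≤u u≤t
  ... | no u≰t  = ¬rotated-high-long {a} {b} t≤a (≰⇒> u≰t) u<n

  ¬rotated-low-by-[2+q] : ∀ {a b} → a < t → b < t → ¬ Rotated (digits b) (digits a) (2 + q)
  ¬rotated-low-by-[2+q] {a} {b} a<t b<t b≈a with suc q <? a
  ... | no 1+q≮a = bit-clash a∋1+q
                     (trans (digits-low a<t (suc q)) (lowDigits-other (≮⇒≥ 1+q≮a) (<⇒≢ 1+q<t) (<⇒≢ (<-trans 1+q<t t<s))))
    where
      1+q<t : suc q < t
      1+q<t = <-trans (n<1+n (suc q)) 2+q<t
      a∋1+q : digits a (suc q) ≡ true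
      a∋1+q = trans (sym (rotated-at (suc q) b≈a t<n [2+q]+[1+q]≡t)) (trans (digits-low b<t t) (lowDigits-t b))
  ... | yes 1+q<a with 2 + q <? b
  ...   | no 2+q≮b = bit-clash b∋2+q
                       (trans (digits-low b<t (2 + q)) (lowDigits-other (≮⇒≥ 2+q≮b) (<⇒≢ 2+q<t) (<⇒≢ (<-trans 2+q<t t<s))))
    where
      b∋2+q : digits b (2 + q) ≡ true
      b∋2+q = trans (rotated-at 0 b≈a (<-trans 2+q<t t<n) (+-identityʳ _))
                    (trans (digits-low a<t 0) (lowDigits-< (≤-trans (s≤s z≤n) 1+q<a)))
  ...   | yes 2+q<b = bit-clash (trans (digits-low b<t 1) (lowDigits-< (≤-trans (s≤s (s≤s z≤n)) 2+q<b)))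
                        (trans (Rotated.at b≈a 1 (≤-trans (s≤s (s≤s z≤n)) (<-trans 2+q<t t<n)))
                               (trans (cong (digits a) rot-1≡1+s)
                                      (trans (digits-low a<t (suc s))
                                             (lowDigits-other (≤-trans (<⇒≤ (<-trans a<t t<s)) (n≤1+n s))
                                                              (>⇒≢ (<-trans t<s (n<1+n s))) (>⇒≢ (n<1+n s))))))
    where
      rot-1≡1+s : rot (2 + q) 1 ≡ suc s
      rot-1≡1+s = trans (rot-< {2 + q} {1} (s≤s (s≤s z≤n)))
                        (trans (cong (_+ 1) (trans (cong (_∸ (2 + q)) (sym [2+q]+s≡n)) (m+n∸m≡n (2 + q) s)))
                               (+-comm s 1))

  ¬rotated-low : ∀ {a b u} → a < t → b < t → 1 ≤ u → u ≤ t → ¬ Rotated (digits b) (digits a) u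
  ¬rotated-low {a} {b} {u} a<t b<t 1≤u u≤t b≈a with t + u ≟ s
  ... | yes t+u≡s = ¬rotated-low-by-[2+q] {a} {b} a<t b<t (subst (Rotated (digits b) (digits a)) u≡2+q b≈a)
    where
      u≡2+q : u ≡ 2 + q
      u≡2+q = +-cancelˡ-≡ t u (2 + q) (trans t+u≡s (sym t+[2+q]≡s))
  ... | no t+u≢s = bit-clash (trans (rotated-at t b≈a t+u<n (+-comm u t)) (trans (digits-low a<t t) (lowDigits-t a)))
                             (trans (digits-low b<t (t + u))
                                    (lowDigits-other (≤-trans (<⇒≤ b<t) (m≤m+n t u)) (>⇒≢ (m<m+n t 1≤u)) t+u≢s))
    where
      t+u<n : t + u < n
      t+u<n = subst (t + u <_) (sym n≡1+t+t) (s≤s (+-monoʳ-≤ t u≤t))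

  ¬rotated : ∀ {a b u} → 1 ≤ u → u < n → ¬ Rotated (digits b) (digits a) u
  ¬rotated {a} {b} {u} 1≤u u<n b≈a with t ≤? a | t ≤? b | u ≤? t
  ... | yes t≤a | _       | _       = ¬rotated-high {a} {b} t≤a 1≤u u<n b≈a
  ... | no _    | yes t≤b | _       = ¬rotated-high {b} {a} t≤b (m<n⇒0<n∸m u<n) (∸-monoʳ-< {n} {u} {0} 1≤u (<⇒≤ u<n))
                                                    (rotated-sym u<n b≈a)
  ... | no t≰a  | no t≰b  | yes u≤t = ¬rotated-low {a} {b} (≰⇒> t≰a) (≰⇒> t≰b) 1≤u u≤t b≈a
  ... | no t≰a  | no t≰b  | no u≰t  = ¬rotated-low {b} {a} (≰⇒> t≰b) (≰⇒> t≰a) (m<n⇒0<n∸m u<n)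
                                                   (≤-trans (∸-monoʳ-≤ n (≰⇒> u≰t)) (≤-reflexive n∸[1+t]≡t))
                                                   (rotated-sym u<n b≈a)

  2^u*2^[v+[n∸u]]≋2^v : ∀ u v → u ≤ n → 2 ^ u * 2 ^ ((v + (n ∸ u)) % n) ≋ 2 ^ v [mod M ]
  2^u*2^[v+[n∸u]]≋2^v u v u≤n = begin
    2 ^ u * 2 ^ ((v + (n ∸ u)) % n)  ≈⟨ ≋-*ˡ (2 ^ u) (2^u≋2^[u%n] (v + (n ∸ u))) ⟨
    2 ^ u * 2 ^ (v + (n ∸ u))        ≡⟨ ^-distribˡ-+-* 2 u (v + (n ∸ u)) ⟨
    2 ^ (u + (v + (n ∸ u)))          ≡⟨ cong (2 ^_) (x∙yz≈y∙xz u v (n ∸ u)) ⟩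
    2 ^ (v + (u + (n ∸ u)))          ≡⟨ cong (λ k → 2 ^ (v + k)) (trans (m+[n∸m]≡n u≤n) (sym (+-identityʳ n))) ⟩
    2 ^ (v + 1 * n)                  ≈⟨ 2^[r+kn]≋2^r v 1 ⟩
    2 ^ v                            ∎
    where open ≋-Reasoning M

  M≋0 : M ≋ 0 [mod M ]
  M≋0 = 0 , 1 , refl

  rotated-digits : ∀ {a w u} → a < n → w < n → u < n →
                   2 ^ u * (d + 2 ^ a) ≋ d + 2 ^ w [mod M ] → Rotated (digits w) (digits a) u
  rotated-digits {a} {w} {u} a<n w<n u<n 2^u[d+2^a]≋d+2^w =
    mkRotated (fromBits-injective n (≋⇒≡ (subst (_< M) (sym (digits-value w w<n)) (d+2^a<M w<n)) rotated<M
                                          (≋-sym rotated≋digits-w)))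
    where
      rotated : ℕ → Bool
      rotated i = digits a (rot u i)
      rotated≋digits-w : fromBits n rotated ≋ fromBits n (digits w) [mod M ]
      rotated≋digits-w = begin
        fromBits n rotated               ≈⟨ subst₂ (λ k l → fromBits k rotated ≋ 2 ^ u * fromBits l (digits a) [mod 2 ^ k ∸ 1 ])
                                                   (m+[n∸m]≡n (<⇒≤ u<n)) (m∸n+n≡m (<⇒≤ u<n)) (rotate-≋ u (n ∸ u) (digits a)) ⟩
        2 ^ u * fromBits n (digits a)    ≡⟨ cong (2 ^ u *_) (digits-value a a<n) ⟩
        2 ^ u * (d + 2 ^ a)              ≈⟨ 2^u[d+2^a]≋d+2^w ⟩
        d + 2 ^ w                        ≡⟨ digits-value w w<n ⟨
        fromBits n (digits w)            ∎
        where open ≋-Reasoning M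
      rotated<M : fromBits n rotated < M
      rotated<M with m≤n⇒m<n∨m≡n (≤-pred (subst (fromBits n rotated <_) 2^n≡1+M (fromBits<2^ n rotated)))
      ... | inj₁ rotated<M = rotated<M
      ... | inj₂ rotated≡M = ⊥-elim (>⇒≢ (<-≤-trans (m^n>0 2 w) (m≤n+m (2 ^ w) d))
                                        (≋⇒≡ (d+2^a<M w<n) 0<M d+2^w≋0))
        where
          d+2^w≋0 : d + 2 ^ w ≋ 0 [mod M ]
          d+2^w≋0 = ≋-trans (≋-trans (≋-reflexive (sym (digits-value w w<n))) (≋-sym rotated≋digits-w))
                            (≋-trans (≋-reflexive rotated≡M) M≋0)

  rigidity-< : ∀ {u v w} → u < n → v < n → w < n →
               d * 2 ^ u + 2 ^ v ≋ d + 2 ^ w [mod M ] → u ≡ 0 × v ≡ w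
  rigidity-< {zero} {v} {w} _ v<n w<n eq rewrite *-identityʳ d =
    refl , 2^-injective (+-cancelˡ-≡ d _ _ (≋⇒≡ (d+2^a<M v<n) (d+2^a<M w<n) eq))
  rigidity-< {u@(suc _)} {v} {w} u<n v<n w<n eq =
    ⊥-elim (¬rotated {a} {w} (s≤s z≤n) u<n (rotated-digits {a} {w} {u} (m%n<n (v + (n ∸ u)) n) w<n u<n 2^u[d+2^a]≋d+2^w))
    where
      open ≋-Reasoning M
      a = (v + (n ∸ u)) % n
      2^u[d+2^a]≋d+2^w : 2 ^ u * (d + 2 ^ a) ≋ d + 2 ^ w [mod M ]
      2^u[d+2^a]≋d+2^w = begin
        2 ^ u * (d + 2 ^ a)          ≡⟨ *-distribˡ-+ (2 ^ u) d (2 ^ a) ⟩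
        2 ^ u * d + 2 ^ u * 2 ^ a    ≡⟨ cong (_+ 2 ^ u * 2 ^ a) (*-comm (2 ^ u) d) ⟩
        d * 2 ^ u + 2 ^ u * 2 ^ a    ≈⟨ ≋-+ ≋-refl (2^u*2^[v+[n∸u]]≋2^v u v (<⇒≤ u<n)) ⟩
        d * 2 ^ u + 2 ^ v            ≈⟨ eq ⟩
        d + 2 ^ w                    ∎

  rigidity : ∀ u v w → d * 2 ^ u + 2 ^ v ≋ d + 2 ^ w [mod M ] → u % n ≡ 0 × v % n ≡ w % n
  rigidity u v w eq = rigidity-< (m%n<n u n) (m%n<n v n) (m%n<n w n) (begin
    d * 2 ^ (u % n) + 2 ^ (v % n)  ≈⟨ ≋-+ (≋-*ˡ d (2^u≋2^[u%n] u)) (2^u≋2^[u%n] v) ⟨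
    d * 2 ^ u + 2 ^ v              ≈⟨ eq ⟩
    d + 2 ^ w                      ≈⟨ ≋-+ ≋-refl (2^u≋2^[u%n] w) ⟩
    d + 2 ^ (w % n)                ∎)
    where open ≋-Reasoning M

  ¬n∣k : ∀ {k} → Coprime k n → ¬ n ∣ k
  ¬n∣k k⊥n n∣k with k⊥n (n∣k , ∣-refl)
  ... | ()

  ¬2^a*d⁻¹≋e : ∀ {k d⁻¹} → Coprime k n → IsInvMod M d d⁻¹ → ∀ a l → ¬ (2 ^ a * d⁻¹ ≋ e l k [mod M ])
  ¬2^a*d⁻¹≋e {k} {d⁻¹} k⊥n dd⁻¹≋1 a l 2^a*d⁻¹≋e =
    ¬n∣k k⊥n (%-≡⇒∣ a k n (proj₂ (rigidity (l * k) a (a + k) shifted)))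
    where
      open ≋-Reasoning M
      E = e l k
      dE≋2^a : d * E ≋ 2 ^ a [mod M ]
      dE≋2^a = begin
        d * E                ≈⟨ ≋-*ˡ d 2^a*d⁻¹≋e ⟨
        d * (2 ^ a * d⁻¹)    ≡⟨ *-CS.x∙yz≈y∙xz d (2 ^ a) d⁻¹ ⟩
        2 ^ a * (d * d⁻¹)    ≈⟨ ≋-*ˡ (2 ^ a) dd⁻¹≋1 ⟩
        2 ^ a * 1            ≡⟨ *-identityʳ (2 ^ a) ⟩
        2 ^ a                ∎
      shifted : d * 2 ^ (l * k) + 2 ^ a ≋ d + 2 ^ (a + k) [mod M ]
      shifted = begin
        d * 2 ^ (l * k) + 2 ^ a      ≈⟨ ≋-+ ≋-refl dE≋2^a ⟨
        d * 2 ^ (l * k) + d * E      ≡⟨ +-comm _ (d * E) ⟩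
        d * E + d * 2 ^ (l * k)      ≡⟨ *-distribˡ-+ d E (2 ^ (l * k)) ⟨
        d * (E + 2 ^ (l * k))        ≡⟨ cong (d *_) (e-shift l k) ⟨
        d * (E * 2 ^ k + 1)          ≡⟨ distrib d E (2 ^ k) ⟩
        d * E * 2 ^ k + d            ≈⟨ ≋-+ (≋-*ʳ (2 ^ k) dE≋2^a) ≋-refl ⟩
        2 ^ a * 2 ^ k + d            ≡⟨ +-comm _ d ⟩
        d + 2 ^ a * 2 ^ k            ≡⟨ cong (d +_) (^-distribˡ-+-* 2 a k) ⟨
        d + 2 ^ (a + k)              ∎
        where
          distrib : ∀ d E B → d * (E * B + 1) ≡ d * E * B + d
          distrib = solve-∀

  ¬2^a*d≋e : ∀ {k} → Coprime k n → ∀ a l → ¬ (2 ^ a * d ≋ e l k [mod M ])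
  ¬2^a*d≋e {k} k⊥n a l 2^a*d≋e =
    ¬n∣k k⊥n (m%n≡0⇒n∣m k n (proj₁ (rigidity k c (l * k + c) shifted)))
    where
      open ≋-Reasoning M
      E = e l k
      -- a n = a + c, so 2^c inverts 2^a modulo M.
      c = a * (t + t)
      2^[an]≡2^a*2^c : 2 ^ (a * n) ≡ 2 ^ a * 2 ^ c
      2^[an]≡2^a*2^c = trans (cong (λ m → 2 ^ (a * m)) n≡1+t+t)
                             (trans (cong (2 ^_) (*-suc a (t + t))) (^-distribˡ-+-* 2 a c))
      lhs : 2 ^ (a * n) * (d * 2 ^ k) + 2 ^ c ≡ 2 ^ c * (2 ^ a * d * 2 ^ k + 1)
      lhs rewrite 2^[an]≡2^a*2^c = identity (2 ^ a) (2 ^ c) d (2 ^ k)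
        where
          identity : ∀ A C d K → A * C * (d * K) + C ≡ C * (A * d * K + 1)
          identity = solve-∀
      rhs : 2 ^ c * (2 ^ a * d + 2 ^ (l * k)) ≡ 2 ^ (a * n) * d + 2 ^ (l * k + c)
      rhs rewrite 2^[an]≡2^a*2^c | ^-distribˡ-+-* 2 (l * k) c = identity (2 ^ a) (2 ^ c) d (2 ^ (l * k))
        where
          identity : ∀ A C d L → C * (A * d + L) ≡ A * C * d + L * C
          identity = solve-∀
      shifted : d * 2 ^ k + 2 ^ c ≋ d + 2 ^ (l * k + c) [mod M ]
      shifted = begin
        d * 2 ^ k + 2 ^ c                        ≈⟨ ≋-+ (2^[an]*x≋x a (d * 2 ^ k)) ≋-refl ⟨
        2 ^ (a * n) * (d * 2 ^ k) + 2 ^ c        ≡⟨ lhs ⟩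
        2 ^ c * (2 ^ a * d * 2 ^ k + 1)          ≈⟨ ≋-*ˡ (2 ^ c) (≋-+ (≋-*ʳ (2 ^ k) 2^a*d≋e) ≋-refl) ⟩
        2 ^ c * (E * 2 ^ k + 1)                  ≡⟨ cong (2 ^ c *_) (e-shift l k) ⟩
        2 ^ c * (E + 2 ^ (l * k))                ≈⟨ ≋-*ˡ (2 ^ c) (≋-+ 2^a*d≋e ≋-refl) ⟨
        2 ^ c * (2 ^ a * d + 2 ^ (l * k))        ≡⟨ rhs ⟩
        2 ^ (a * n) * d + 2 ^ (l * k + c)        ≈⟨ ≋-+ (2^[an]*x≋x a d) ≋-refl ⟩
        d + 2 ^ (l * k + c)                      ∎

  ¬cyclotomic-equivalent : ∀ {k d⁻¹} → Coprime k n → IsInvMod M (nihoExp t) d⁻¹ → ∀ l → ¬ CycEquiv n d⁻¹ (e l k)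
  ¬cyclotomic-equivalent {k} {d⁻¹} k⊥n inverse l = λ
    { (inj₁ (a , 2^a*d⁻¹≋e)) → ¬2^a*d⁻¹≋e k⊥n dd⁻¹≋1 a l 2^a*d⁻¹≋e
    ; (inj₂ (_ , x , d⁻¹x≋1 , a , 2^a*x≋e)) →
        ¬2^a*d≋e k⊥n a l (≋-trans (≋-*ˡ (2 ^ a) (≋-sym (inverse-involutive dd⁻¹≋1 d⁻¹x≋1))) 2^a*x≋e)
    }
    where
      dd⁻¹≋1 : IsInvMod M d d⁻¹
      dd⁻¹≋1 = subst (λ x → IsInvMod M x d⁻¹) nihoExp≡d inverse

theorem9 : ∀ (t k : ℕ) → 1 < t → ¬ (2 ∣ t) → Coprime k (2 * t + 1) →
           ∀ (dinv : ℕ) → IsInvMod (2 ^ (2 * t + 1) ∸ 1) (nihoExp t) dinv →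
           ∀ (l : ℕ) → ¬ CycEquiv (2 * t + 1) dinv (e l k)
theorem9 t k 1<t 2∤t k⊥n dinv inverse l with odd>1⇒3+2* t 1<t 2∤t
... | q , refl = Niho.¬cyclotomic-equivalent q k⊥n inverse l
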